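{- Write $Q:= 3^\ell$ with $\ell\ge 5$. Let $n_1,n_2,n_5,n_9$ be nonnegative integers for which $n_1+2n_2+5n_5+9n_9=Q-1$ and the union of the base-$3$ expansions of the $n_j$'s consists of one copy of each $3^i$ with $0\le i\le \ell-2$ and $i\ne 2$, along with either one copy of $2\cdot 9$ or two copies of $9$. Then the base-$3$ expansion of $n_5$ contains $Q/9$, and if $\ell\ge 6$ then the base-$3$ expansion of $n_9$ contains $Q/27$.
   Context: A term of the base-$p$ expansion of a nonnegative integer $m=\sum_j b_jp^j$ ($0\le b_j\le p-1$) is some $b_jp^j$ with $b_j>0$; the union of the base-$p$ expansions of several integers means the multiset of all terms of all of them. -}

module Defs where

open import Data.Nat using (ℕ; zero; suc; _+_; _*_; _^_; _∸_; NonZero)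
open import Data.Nat.DivMod using (_/_; _%_)
open import Data.Nat.Properties using (_≟_)
open import Data.List using (List; []; _∷_; map; filter; upTo)
open import Relation.Nullary.Decidable using (¬?)

-- Terms of the base-p expansion of m, from the lowest position upwards:
-- the list of all b_j * p^j with b_j > 0, where m = Σ b_j p^j, 0 ≤ b_j ≤ p-1.
-- 'go fuel pw m' processes m with current place value pw.
expansionGo : (p : ℕ) → .{{NonZero p}} → ℕ → ℕ → ℕ → List ℕ
expansionGo p zero    pw m = []
expansionGo p (suc f) pw m with m % p
... | zero  = expansionGo p f (pw * p) (m / p)
... | suc d = suc d * pw ∷ expansionGo p f (pw * p) (m / p)

-- m + 1 digits always suffice (p ≥ 2 gives p^(m+1) > m; for p = 1 the
-- notion is degenerate and not used).
expansion : (p : ℕ) → .{{NonZero p}} → ℕ → List ℕ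
expansion p m = expansionGo p (suc m) 1 m

lowPowers : ℕ → List ℕ
lowPowers ℓ = map (3 ^_) (filter (λ i → ¬? (i ≟ 2)) (upTo (ℓ ∸ 1)))

-- Put Q = 3^ℓ = 243 r with r = 3^(ℓ-5). Since the expansion of n sums to n, counting the
-- terms gives 2 (n₁ + n₂ + n₅ + n₉) = 81 r + 17, and together with n₁ + 2n₂ + 5n₅ + 9n₉ = 243 r - 1
-- this eliminates n₉: 16 n₁ + 14 n₂ + 8 n₅ = 243 r + 155. A term of the expansion of n is at most n.
-- If the term Q/9 = 27 r lay in n₉ the weighted sum would exceed Q - 1, and in n₁ or n₂ the left
-- side above would exceed 243 r + 155, except for r = 1 with n₂, where the excess is exactly 20,
-- which 16, 14 and 8 cannot make up. Once 27 r is in n₅, the term Q/27 = 9 r is excluded from n₁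
-- and n₂ in the same way, and from n₅ because then n₅ ≥ 36 r (again a remainder of 20 when r = 3).

module Submission where

open import Defs
open import Data.Nat using (ℕ; zero; suc; _+_; _*_; _^_; _∸_; _≤_; _<_; _≰_; s≤s; z≤n; z<s; NonZero; >-nonZero)
open import Data.Nat.Properties
open import Data.Nat.DivMod using (_/_; _%_; m≡m%n+[m/n]*n; m<n*o⇒m/o<n; m*n/n≡m)
open import Data.Nat.ListAction using (sum)
open import Data.Nat.ListAction.Properties using (sum-++; sum-↭)
open import Data.Nat.Tactic.RingSolver using (solve-∀)
open import Data.List using (List; []; _∷_; _++_; map; applyUpTo)
open import Data.List.Properties using (applyUpTo-∷ʳ; map-++; filter-all)
open import Data.List.Relation.Unary.All.Properties using (applyUpTo⁺₂)
open import Data.List.Membership.Propositional.Properties using (∈-map⁺; ∈-filter⁺; ∈-upTo⁺; ∈-++⁻; ∈-++⁺ˡ)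
open import Data.List.Membership.Propositional using (_∈_)
open import Data.List.Relation.Unary.Any using (here; there)
open import Data.List.Relation.Binary.Permutation.Propositional using (_↭_; ↭-sym)
open import Data.List.Relation.Binary.Permutation.Propositional.Properties using (∈-resp-↭)
open import Data.Product using (_×_; _,_)
open import Data.Sum as Sum using (_⊎_; inj₁; inj₂)
open import Function using (_∘_)
open import Relation.Binary.PropositionalEquality
open import Relation.Nullary using (contradiction; ¬?)

module _ (p : ℕ) .{{_ : NonZero p}} where

  sum-expansionGo-suc : ∀ f pw m →
    sum (expansionGo p (suc f) pw m) ≡ m % p * pw + sum (expansionGo p f (pw * p) (m / p))
  sum-expansionGo-suc f pw m with m % p
  ... | zero  = refl
  ... | suc d = refl

  sum-expansionGo : ∀ f pw m → m < p ^ f → sum (expansionGo p f pw m) ≡ pw * m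
  sum-expansionGo zero    pw zero    _         = sym (*-zeroʳ pw)
  sum-expansionGo zero    pw (suc m) (s≤s ())
  sum-expansionGo (suc f) pw m m<p^f = begin
    sum (expansionGo p (suc f) pw m)                      ≡⟨ sum-expansionGo-suc f pw m ⟩
    m % p * pw + sum (expansionGo p f (pw * p) (m / p))   ≡⟨ cong (m % p * pw +_) (sum-expansionGo f (pw * p) (m / p) m/p<p^f) ⟩
    m % p * pw + pw * p * (m / p)                         ≡⟨ regroup (m % p) (m / p) pw p ⟩
    pw * (m % p + m / p * p)                              ≡⟨ cong (pw *_) (m≡m%n+[m/n]*n m p) ⟨
    pw * m                                                ∎
    where
    open ≡-Reasoning
    m/p<p^f : m / p < p ^ f
    m/p<p^f = m<n*o⇒m/o<n (subst (m <_) (*-comm p (p ^ f)) m<p^f)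
    regroup : ∀ a b pw p → a * pw + pw * p * b ≡ pw * (a + b * p)
    regroup = solve-∀

  n<p^n : 1 < p → ∀ n → n < p ^ n
  n<p^n 1<p zero    = s≤s z≤n
  n<p^n 1<p (suc n) = ≤-<-trans (n<p^n 1<p n)
    (subst (p ^ n <_) (*-comm (p ^ n) p) (m<m*n (p ^ n) p {{m^n≢0 p n}} 1<p))

  sum-expansion : 1 < p → ∀ m → sum (expansion p m) ≡ m
  sum-expansion 1<p m = trans
    (sum-expansionGo (suc m) 1 m (<-trans (n<p^n 1<p m) (^-monoʳ-< p 1<p (n<1+n m))))
    (*-identityˡ m)

∈⇒≤sum : ∀ {x xs} → x ∈ xs → x ≤ sum xs
∈⇒≤sum {x} {_ ∷ xs} (here refl) = m≤m+n x (sum xs)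
∈⇒≤sum {x} {y ∷ xs} (there x∈xs) = ≤-trans (∈⇒≤sum x∈xs) (m≤n+m (sum xs) y)

∈-∈-≢⇒+≤sum : ∀ {x y xs} → x ∈ xs → y ∈ xs → x ≢ y → x + y ≤ sum xs
∈-∈-≢⇒+≤sum (here refl) (here refl) x≢y = contradiction refl x≢y
∈-∈-≢⇒+≤sum {x} (here refl) (there y∈xs) _ = +-monoʳ-≤ x (∈⇒≤sum y∈xs)
∈-∈-≢⇒+≤sum {x} {y} {_ ∷ xs} (there x∈xs) (here refl) _ = subst (_≤ y + sum xs) (+-comm y x) (+-monoʳ-≤ y (∈⇒≤sum x∈xs))
∈-∈-≢⇒+≤sum {xs = z ∷ xs} (there x∈xs) (there y∈xs) x≢y = ≤-trans (∈-∈-≢⇒+≤sum x∈xs y∈xs x≢y) (m≤n+m (sum xs) z)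

module _ {p : ℕ} .{{_ : NonZero p}} (1<p : 1 < p) where

  ∈-expansion⇒≤ : ∀ {x} m → x ∈ expansion p m → x ≤ m
  ∈-expansion⇒≤ m x∈ = subst (_ ≤_) (sum-expansion p 1<p m) (∈⇒≤sum x∈)

  ∈-∈-≢-expansion⇒+≤ : ∀ {x y} m → x ∈ expansion p m → y ∈ expansion p m → x ≢ y → x + y ≤ m
  ∈-∈-≢-expansion⇒+≤ m x∈ y∈ x≢y = subst (_ ≤_) (sum-expansion p 1<p m) (∈-∈-≢⇒+≤sum x∈ y∈ x≢y)

geometric-sum : ∀ b c n → sum (map (suc b ^_) (applyUpTo (c +_) n)) * b + suc b ^ c ≡ suc b ^ (c + n)
geometric-sum b c zero = cong (suc b ^_) (sym (+-identityʳ c))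
geometric-sum b c (suc n) = begin
  sum (map (suc b ^_) (applyUpTo (c +_) (suc n))) * b + suc b ^ c
    ≡⟨ cong (λ is → sum (map (suc b ^_) is) * b + suc b ^ c) (applyUpTo-∷ʳ (c +_) n) ⟨
  sum (map (suc b ^_) (applyUpTo (c +_) n ++ c + n ∷ [])) * b + suc b ^ c
    ≡⟨ cong (λ xs → sum xs * b + suc b ^ c) (map-++ (suc b ^_) (applyUpTo (c +_) n) (c + n ∷ [])) ⟩
  sum (xs ++ x ∷ []) * b + suc b ^ c
    ≡⟨ cong (λ s → s * b + suc b ^ c) (sum-++ xs (x ∷ [])) ⟩
  (sum xs + (x + 0)) * b + suc b ^ c
    ≡⟨ regroup (sum xs) x b (suc b ^ c) ⟩
  (sum xs * b + suc b ^ c) + x * b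
    ≡⟨ cong (_+ x * b) (geometric-sum b c n) ⟩
  x + x * b
    ≡⟨ cong (x +_) (*-comm x b) ⟩
  suc b ^ suc (c + n)
    ≡⟨ cong (suc b ^_) (+-suc c n) ⟨
  suc b ^ (c + suc n) ∎
  where
  open ≡-Reasoning
  xs = map (suc b ^_) (applyUpTo (c +_) n)
  x = suc b ^ (c + n)
  regroup : ∀ s x b y → (s + (x + 0)) * b + y ≡ (s * b + y) + x * b
  regroup = solve-∀

lowPowers-shape : ∀ n → lowPowers (4 + n) ≡ 1 ∷ 3 ∷ map (3 ^_) (applyUpTo (3 +_) n)
lowPowers-shape n = cong (λ is → 1 ∷ 3 ∷ map (3 ^_) is) (filter-all _ (applyUpTo⁺₂ (3 +_) n (λ i ())))

twice-sum-lowPowers : ∀ n → 2 * sum (lowPowers (4 + n)) + 19 ≡ 3 ^ (3 + n)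
twice-sum-lowPowers n = begin
  2 * sum (lowPowers (4 + n)) + 19 ≡⟨ cong (λ xs → 2 * sum xs + 19) (lowPowers-shape n) ⟩
  2 * (4 + S) + 19                 ≡⟨ regroup S ⟩
  S * 2 + 27                       ≡⟨ geometric-sum 2 3 n ⟩
  3 ^ (3 + n)                      ∎
  where
  open ≡-Reasoning
  S = sum (map (3 ^_) (applyUpTo (3 +_) n))
  regroup : ∀ s → 2 * (4 + s) + 19 ≡ s * 2 + 27
  regroup = solve-∀

3^i∈lowPowers : ∀ {i} ℓ → i ≢ 2 → i < ℓ ∸ 1 → 3 ^ i ∈ lowPowers ℓ
3^i∈lowPowers ℓ i≢2 i<ℓ-1 = ∈-map⁺ (3 ^_) (∈-filter⁺ (λ i → ¬? (i ≟ 2)) (∈-upTo⁺ i<ℓ-1) i≢2)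

m^[n+o]/m^n≡m^o : ∀ m n o .{{_ : NonZero (m ^ n)}} → m ^ (n + o) / m ^ n ≡ m ^ o
m^[n+o]/m^n≡m^o m n o = begin
  m ^ (n + o) / m ^ n    ≡⟨ cong (_/ m ^ n) (trans (^-distribˡ-+-* m n o) (*-comm (m ^ n) (m ^ o))) ⟩
  m ^ o * m ^ n / m ^ n  ≡⟨ m*n/n≡m (m ^ o) (m ^ n) ⟩
  m ^ o                  ∎
  where open ≡-Reasoning

form : ℕ → ℕ → ℕ → ℕ
form n₁ n₂ n₅ = n₁ * 16 + n₂ * 14 + n₅ * 8

FormEquation : ℕ → ℕ → ℕ → ℕ → Set
FormEquation r n₁ n₂ n₅ = form n₁ n₂ n₅ ≡ 243 * r + 155

form-equation : ∀ r n₁ n₂ n₅ n₉ →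
  n₁ + 2 * n₂ + 5 * n₅ + 9 * n₉ + 1 ≡ 243 * r →
  2 * (n₁ + (n₂ + (n₅ + n₉))) ≡ 81 * r + 17 →
  FormEquation r n₁ n₂ n₅
form-equation r n₁ n₂ n₅ n₉ weight twice-count = +-cancelʳ-≡ (2 * (243 * r)) _ _ (begin
  form n₁ n₂ n₅ + 2 * (243 * r)                          ≡⟨ cong (λ w → form n₁ n₂ n₅ + 2 * w) weight ⟨
  form n₁ n₂ n₅ + 2 * (n₁ + 2 * n₂ + 5 * n₅ + 9 * n₉ + 1) ≡⟨ eliminate-n₉ n₁ n₂ n₅ n₉ ⟩
  9 * (2 * (n₁ + (n₂ + (n₅ + n₉)))) + 2                  ≡⟨ cong (λ s → 9 * s + 2) twice-count ⟩
  9 * (81 * r + 17) + 2                                  ≡⟨ regroup r ⟩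
  243 * r + 155 + 2 * (243 * r)                          ∎)
  where
  open ≡-Reasoning
  eliminate-n₉ : ∀ n₁ n₂ n₅ n₉ →
    n₁ * 16 + n₂ * 14 + n₅ * 8 + 2 * (n₁ + 2 * n₂ + 5 * n₅ + 9 * n₉ + 1) ≡ 9 * (2 * (n₁ + (n₂ + (n₅ + n₉)))) + 2
  eliminate-n₉ = solve-∀
  regroup : ∀ r → 9 * (81 * r + 17) + 2 ≡ 243 * r + 155 + 2 * (243 * r)
  regroup = solve-∀

form-mono : ∀ {a b c a′ b′ c′} → a ≤ a′ → b ≤ b′ → c ≤ c′ → form a b c ≤ form a′ b′ c′
form-mono a≤ b≤ c≤ = +-mono-≤ (+-mono-≤ (*-monoˡ-≤ 16 a≤) (*-monoˡ-≤ 14 b≤)) (*-monoˡ-≤ 8 c≤)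

form-+ : ∀ a b c a′ b′ c′ → form (a + a′) (b + b′) (c + c′) ≡ form a b c + form a′ b′ c′
form-+ = distribute
  where
  distribute : ∀ a b c a′ b′ c′ →
    (a + a′) * 16 + (b + b′) * 14 + (c + c′) * 8 ≡ a * 16 + b * 14 + c * 8 + (a′ * 16 + b′ * 14 + c′ * 8)
  distribute = solve-∀

form≢20 : ∀ a b c → form a b c ≢ 20
form≢20 zero          zero          zero                ()
form≢20 zero          zero          (suc zero)          ()
form≢20 zero          zero          (suc (suc zero))    ()
form≢20 zero          zero          (suc (suc (suc c))) ()
form≢20 zero          (suc zero)    zero                ()
form≢20 zero          (suc zero)    (suc c)             ()
form≢20 zero          (suc (suc b)) c                   ()
form≢20 (suc zero)    zero          zero                ()
form≢20 (suc zero)    zero          (suc c)             ()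
form≢20 (suc zero)    (suc b)       c                   ()
form≢20 (suc (suc a)) b             c                   ()

module _ (n₁ n₂ n₅ : ℕ) {N a b c : ℕ} (form-eq : form n₁ n₂ n₅ ≡ N) (a≤n₁ : a ≤ n₁) (b≤n₂ : b ≤ n₂) (c≤n₅ : c ≤ n₅) where

  form-≢-overshoot : ∀ d → form a b c ≢ N + suc d
  form-≢-overshoot d overshoot =
    m+1+n≰m N (subst (_≤ N) overshoot (subst (form a b c ≤_) form-eq (form-mono a≤n₁ b≤n₂ c≤n₅)))

  form-≢-gap20 : form a b c + 20 ≢ N
  form-≢-gap20 gap = form≢20 (n₁ ∸ a) (n₂ ∸ b) (n₅ ∸ c) (+-cancelˡ-≡ (form a b c) _ _ (begin
    form a b c + form (n₁ ∸ a) (n₂ ∸ b) (n₅ ∸ c)            ≡⟨ form-+ a b c _ _ _ ⟨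
    form (a + (n₁ ∸ a)) (b + (n₂ ∸ b)) (c + (n₅ ∸ c))     ≡⟨ cong₂ (λ x y → form x y (c + (n₅ ∸ c))) (m+[n∸m]≡n a≤n₁) (m+[n∸m]≡n b≤n₂) ⟩
    form n₁ n₂ (c + (n₅ ∸ c))                             ≡⟨ cong (form n₁ n₂) (m+[n∸m]≡n c≤n₅) ⟩
    form n₁ n₂ n₅                                         ≡⟨ form-eq ⟩
    N                                                     ≡⟨ gap ⟨
    form a b c + 20                                       ∎))
    where open ≡-Reasoning

27r≰n₁ : ∀ {r} n₁ n₂ n₅ → FormEquation r n₁ n₂ n₅ → 1 ≤ r → 27 * r ≰ n₁
27r≰n₁ n₁ n₂ n₅ form-eq (s≤s (z≤n {r})) 27r≤n₁ =
  form-≢-overshoot n₁ n₂ n₅ form-eq 27r≤n₁ z≤n z≤n _ (excess r)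
  where
  excess : ∀ r → (27 * suc r) * 16 + 0 * 14 + 0 * 8 ≡ 243 * suc r + 155 + suc (33 + 189 * r)
  excess = solve-∀

27r≰n₂ : ∀ {r} n₁ n₂ n₅ → FormEquation r n₁ n₂ n₅ → 1 ≤ r → 27 * r ≰ n₂
27r≰n₂ n₁ n₂ n₅ form-eq (s≤s (z≤n {zero}))  27r≤n₂ = form-≢-gap20 n₁ n₂ n₅ form-eq z≤n 27r≤n₂ z≤n refl
27r≰n₂ n₁ n₂ n₅ form-eq (s≤s (z≤n {suc r})) 27r≤n₂ =
  form-≢-overshoot n₁ n₂ n₅ form-eq z≤n 27r≤n₂ z≤n _ (excess r)
  where
  excess : ∀ r → 0 * 16 + (27 * (2 + r)) * 14 + 0 * 8 ≡ 243 * (2 + r) + 155 + suc (114 + 135 * r)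
  excess = solve-∀

9r≰n₁ : ∀ {r} n₁ n₂ n₅ → FormEquation r n₁ n₂ n₅ → 3 ≤ r → 27 * r ≤ n₅ → 9 * r ≰ n₁
9r≰n₁ n₁ n₂ n₅ form-eq (s≤s (s≤s (s≤s (z≤n {r})))) 27r≤n₅ 9r≤n₁ =
  form-≢-overshoot n₁ n₂ n₅ form-eq 9r≤n₁ z≤n 27r≤n₅ _ (excess r)
  where
  excess : ∀ r → (9 * (3 + r)) * 16 + 0 * 14 + (27 * (3 + r)) * 8 ≡ 243 * (3 + r) + 155 + suc (195 + 117 * r)
  excess = solve-∀

9r≰n₂ : ∀ {r} n₁ n₂ n₅ → FormEquation r n₁ n₂ n₅ → 3 ≤ r → 27 * r ≤ n₅ → 9 * r ≰ n₂
9r≰n₂ n₁ n₂ n₅ form-eq (s≤s (s≤s (s≤s (z≤n {r})))) 27r≤n₅ 9r≤n₂ =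
  form-≢-overshoot n₁ n₂ n₅ form-eq z≤n 9r≤n₂ 27r≤n₅ _ (excess r)
  where
  excess : ∀ r → 0 * 16 + (9 * (3 + r)) * 14 + (27 * (3 + r)) * 8 ≡ 243 * (3 + r) + 155 + suc (141 + 99 * r)
  excess = solve-∀

36r≰n₅ : ∀ {r} n₁ n₂ n₅ → FormEquation r n₁ n₂ n₅ → 3 ≤ r → 36 * r ≰ n₅
36r≰n₅ n₁ n₂ n₅ form-eq (s≤s (s≤s (s≤s (z≤n {zero}))))  36r≤n₅ = form-≢-gap20 n₁ n₂ n₅ form-eq z≤n z≤n 36r≤n₅ refl
36r≰n₅ n₁ n₂ n₅ form-eq (s≤s (s≤s (s≤s (z≤n {suc r})))) 36r≤n₅ =
  form-≢-overshoot n₁ n₂ n₅ form-eq z≤n z≤n 36r≤n₅ _ (excess r)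
  where
  excess : ∀ r → 0 * 16 + 0 * 14 + (36 * (4 + r)) * 8 ≡ 243 * (4 + r) + 155 + suc (24 + 45 * r)
  excess = solve-∀

terms : ℕ → ℕ → ℕ → ℕ → List ℕ
terms n₁ n₂ n₅ n₉ = expansion 3 n₁ ++ expansion 3 n₂ ++ expansion 3 n₅ ++ expansion 3 n₉

1<3 : 1 < 3
1<3 = s≤s (s≤s z≤n)

sum-terms : ∀ n₁ n₂ n₅ n₉ → sum (terms n₁ n₂ n₅ n₉) ≡ n₁ + (n₂ + (n₅ + n₉))
sum-terms n₁ n₂ n₅ n₉ = begin
  sum (terms n₁ n₂ n₅ n₉)
    ≡⟨ sum-++ (E n₁) _ ⟩
  sum (E n₁) + sum (E n₂ ++ E n₅ ++ E n₉)
    ≡⟨ cong (sum (E n₁) +_) (sum-++ (E n₂) _) ⟩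
  sum (E n₁) + (sum (E n₂) + sum (E n₅ ++ E n₉))
    ≡⟨ cong (λ s → sum (E n₁) + (sum (E n₂) + s)) (sum-++ (E n₅) _) ⟩
  sum (E n₁) + (sum (E n₂) + (sum (E n₅) + sum (E n₉)))
    ≡⟨ cong₂ _+_ (Σ n₁) (cong₂ _+_ (Σ n₂) (cong₂ _+_ (Σ n₅) (Σ n₉))) ⟩
  n₁ + (n₂ + (n₅ + n₉)) ∎
  where
  open ≡-Reasoning
  E = expansion 3
  Σ = sum-expansion 3 1<3

∈-terms⁻ : ∀ {x} n₁ n₂ n₅ n₉ → x ∈ terms n₁ n₂ n₅ n₉ →
  x ∈ expansion 3 n₁ ⊎ x ∈ expansion 3 n₂ ⊎ x ∈ expansion 3 n₅ ⊎ x ∈ expansion 3 n₉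
∈-terms⁻ n₁ n₂ n₅ n₉ x∈ = Sum.map₂ (Sum.map₂ (∈-++⁻ (expansion 3 n₅)) ∘ ∈-++⁻ (expansion 3 n₂)) (∈-++⁻ (expansion 3 n₁) x∈)

module Placement (r n₁ n₂ n₅ n₉ : ℕ)
  (weight : n₁ + 2 * n₂ + 5 * n₅ + 9 * n₉ + 1 ≡ 243 * r)
  (form-eq : FormEquation r n₁ n₂ n₅)
  where

  27r≰n₉ : 27 * r ≰ n₉
  27r≰n₉ 27r≤n₉ = <⇒≱ W<243r 243r≤W
    where
    W = n₁ + 2 * n₂ + 5 * n₅ + 9 * n₉
    W<243r : W < 243 * r
    W<243r = subst (W <_) weight (m<m+n W z<s)
    243r≤W : 243 * r ≤ W
    243r≤W = begin
      243 * r      ≡⟨ *-assoc 9 27 r ⟩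
      9 * (27 * r) ≤⟨ *-monoʳ-≤ 9 27r≤n₉ ⟩
      9 * n₉       ≤⟨ m≤n+m (9 * n₉) (n₁ + 2 * n₂ + 5 * n₅) ⟩
      W            ∎
      where open ≤-Reasoning

  27r∈terms⇒27r∈n₅ : 1 ≤ r → 27 * r ∈ terms n₁ n₂ n₅ n₉ → 27 * r ∈ expansion 3 n₅
  27r∈terms⇒27r∈n₅ 1≤r t∈ with ∈-terms⁻ n₁ n₂ n₅ n₉ t∈
  ... | inj₁ t∈n₁                = contradiction (∈-expansion⇒≤ 1<3 n₁ t∈n₁) (27r≰n₁ n₁ n₂ n₅ form-eq 1≤r)
  ... | inj₂ (inj₁ t∈n₂)         = contradiction (∈-expansion⇒≤ 1<3 n₂ t∈n₂) (27r≰n₂ n₁ n₂ n₅ form-eq 1≤r)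
  ... | inj₂ (inj₂ (inj₁ t∈n₅)) = t∈n₅
  ... | inj₂ (inj₂ (inj₂ t∈n₉)) = contradiction (∈-expansion⇒≤ 1<3 n₉ t∈n₉) 27r≰n₉

  9r∈terms⇒9r∈n₉ : 3 ≤ r → 27 * r ∈ expansion 3 n₅ → 9 * r ∈ terms n₁ n₂ n₅ n₉ → 9 * r ∈ expansion 3 n₉
  9r∈terms⇒9r∈n₉ 3≤r 27r∈n₅ t∈ with ∈-terms⁻ n₁ n₂ n₅ n₉ t∈
  ... | inj₁ t∈n₁                = contradiction (∈-expansion⇒≤ 1<3 n₁ t∈n₁) (9r≰n₁ n₁ n₂ n₅ form-eq 3≤r (∈-expansion⇒≤ 1<3 n₅ 27r∈n₅))
  ... | inj₂ (inj₁ t∈n₂)         = contradiction (∈-expansion⇒≤ 1<3 n₂ t∈n₂) (9r≰n₂ n₁ n₂ n₅ form-eq 3≤r (∈-expansion⇒≤ 1<3 n₅ 27r∈n₅))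
  ... | inj₂ (inj₂ (inj₁ t∈n₅)) = contradiction 36r≤n₅ (36r≰n₅ n₁ n₂ n₅ form-eq 3≤r)
    where
    27r≢9r : 27 * r ≢ 9 * r
    27r≢9r e with () ← *-cancelʳ-≡ 27 9 r {{>-nonZero (≤-trans (s≤s z≤n) 3≤r)}} e
    36r≤n₅ : 36 * r ≤ n₅
    36r≤n₅ = subst (_≤ n₅) (sym (*-distribʳ-+ r 27 9)) (∈-∈-≢-expansion⇒+≤ 1<3 n₅ 27r∈n₅ t∈n₅ 27r≢9r)
  ... | inj₂ (inj₂ (inj₂ t∈n₉)) = t∈n₉

lemma4p2-with-extra : ∀ k n₁ n₂ n₅ n₉ (extra : List ℕ) → sum extra ≡ 18 →
  n₁ + 2 * n₂ + 5 * n₅ + 9 * n₉ ≡ 3 ^ (5 + k) ∸ 1 →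
  terms n₁ n₂ n₅ n₉ ↭ lowPowers (5 + k) ++ extra →
  (3 ^ (5 + k) / 9 ∈ expansion 3 n₅) × (6 ≤ 5 + k → 3 ^ (5 + k) / 27 ∈ expansion 3 n₉)
lemma4p2-with-extra k n₁ n₂ n₅ n₉ extra sum-extra weight terms↭ = Q/9∈n₅ , Q/27∈n₉
  where
  open ≡-Reasoning
  r = 3 ^ k

  weight′ : n₁ + 2 * n₂ + 5 * n₅ + 9 * n₉ + 1 ≡ 243 * r
  weight′ = trans (cong (_+ 1) weight) (trans (m∸n+n≡m (m^n>0 3 (5 + k))) (^-distribˡ-+-* 3 5 k))

  twice-count : 2 * (n₁ + (n₂ + (n₅ + n₉))) ≡ 81 * r + 17
  twice-count = begin
    2 * (n₁ + (n₂ + (n₅ + n₉)))                ≡⟨ cong (2 *_) (sum-terms n₁ n₂ n₅ n₉) ⟨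
    2 * sum (terms n₁ n₂ n₅ n₉)                ≡⟨ cong (2 *_) (sum-↭ terms↭) ⟩
    2 * sum (lowPowers (5 + k) ++ extra)       ≡⟨ cong (2 *_) (sum-++ (lowPowers (5 + k)) extra) ⟩
    2 * (sum (lowPowers (5 + k)) + sum extra)  ≡⟨ cong (λ e → 2 * (sum (lowPowers (5 + k)) + e)) sum-extra ⟩
    2 * (sum (lowPowers (5 + k)) + 18)         ≡⟨ regroup (sum (lowPowers (5 + k))) ⟩
    2 * sum (lowPowers (5 + k)) + 19 + 17      ≡⟨ cong (_+ 17) (trans (twice-sum-lowPowers (suc k)) (^-distribˡ-+-* 3 4 k)) ⟩
    81 * r + 17                                ∎
    where
    regroup : ∀ s → 2 * (s + 18) ≡ 2 * s + 19 + 17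
    regroup = solve-∀

  form-eq : FormEquation r n₁ n₂ n₅
  form-eq = form-equation r n₁ n₂ n₅ n₉ weight′ twice-count

  open Placement r n₁ n₂ n₅ n₉ weight′ form-eq

  term : ∀ {i} → i ≢ 2 → i < 4 + k → 3 ^ i ∈ terms n₁ n₂ n₅ n₉
  term i≢2 i<4+k = ∈-resp-↭ (↭-sym terms↭) (∈-++⁺ˡ (3^i∈lowPowers (5 + k) i≢2 i<4+k))

  27r∈n₅ : 27 * r ∈ expansion 3 n₅
  27r∈n₅ = 27r∈terms⇒27r∈n₅ (m^n>0 3 k) (subst (_∈ terms n₁ n₂ n₅ n₉) (^-distribˡ-+-* 3 3 k) (term (λ ()) (n<1+n (3 + k))))

  Q/9∈n₅ : 3 ^ (5 + k) / 9 ∈ expansion 3 n₅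
  Q/9∈n₅ = subst (_∈ expansion 3 n₅) (sym (trans (m^[n+o]/m^n≡m^o 3 2 (3 + k)) (^-distribˡ-+-* 3 3 k))) 27r∈n₅

  Q/27∈n₉ : 6 ≤ 5 + k → 3 ^ (5 + k) / 27 ∈ expansion 3 n₉
  Q/27∈n₉ 6≤ℓ = subst (_∈ expansion 3 n₉) (sym (trans (m^[n+o]/m^n≡m^o 3 3 (2 + k)) (^-distribˡ-+-* 3 2 k)))
    (9r∈terms⇒9r∈n₉ (^-monoʳ-≤ 3 1≤k) 27r∈n₅
      (subst (_∈ terms n₁ n₂ n₅ n₉) (^-distribˡ-+-* 3 2 k) (term 2+k≢2 (<-trans (n<1+n (2 + k)) (n<1+n (3 + k))))))
    where
    1≤k : 1 ≤ k
    1≤k = +-cancelˡ-≤ 5 1 k 6≤ℓ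
    2+k≢2 : 2 + k ≢ 2
    2+k≢2 e with () ← subst (1 ≤_) (+-cancelˡ-≡ 2 k 0 e) 1≤k

lemma4p2 : (ℓ n₁ n₂ n₅ n₉ : ℕ) → 5 ≤ ℓ →
    n₁ + 2 * n₂ + 5 * n₅ + 9 * n₉ ≡ 3 ^ ℓ ∸ 1 →
    ((expansion 3 n₁ ++ expansion 3 n₂ ++ expansion 3 n₅ ++ expansion 3 n₉) ↭ (lowPowers ℓ ++ (2 * 9 ∷ []))
    ⊎ (expansion 3 n₁ ++ expansion 3 n₂ ++ expansion 3 n₅ ++ expansion 3 n₉) ↭ (lowPowers ℓ ++ (9 ∷ 9 ∷ []))) →
    (3 ^ ℓ / 9 ∈ expansion 3 n₅) × (6 ≤ ℓ → 3 ^ ℓ / 27 ∈ expansion 3 n₉)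
lemma4p2 _ n₁ n₂ n₅ n₉ (s≤s (s≤s (s≤s (s≤s (s≤s (z≤n {k})))))) weight (inj₁ terms↭) =
  lemma4p2-with-extra k n₁ n₂ n₅ n₉ (2 * 9 ∷ []) refl weight terms↭
lemma4p2 _ n₁ n₂ n₅ n₉ (s≤s (s≤s (s≤s (s≤s (s≤s (z≤n {k})))))) weight (inj₂ terms↭) =
  lemma4p2-with-extra k n₁ n₂ n₅ n₉ (9 ∷ 9 ∷ []) refl weight terms↭
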